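{- Assume the recurrent-pair setting described in the context. Then for all $m,n\in\mathbb{N}$ with $n\ge n_2$ there exist $m',n'\in\mathbb{N}$ with $n'\ge n_2$ such that $c_1[m,n]\ (\Rightarrow_{w_1}^*\circ\Rightarrow_{w_2})\ c_1[m',n']$, i.e. $c_1[m',n']$ is reached from $c_1[m,n]$ by zero or more $\Rightarrow_{w_1}$-steps followed by exactly one $\Rightarrow_{w_2}$-step.
   Context: $\Sigma$ is a signature, $X$ a countably infinite set of variables, $T(\Sigma,X)$ the terms; $\square,\square'$ are distinct fresh constants. An ARS $(T(\Sigma,X),\Rightarrow_\Pi)$ has $\Rightarrow_\Pi=\bigcup_{\pi\in\Pi}\Rightarrow_\pi$ for binary relations $\Rightarrow_\pi$ on terms; for $w=\langle\pi_1,\dots,\pi_k\rangle\in\Pi^*$, $\Rightarrow_w$ is the composition $\Rightarrow_{\pi_1}\circ\cdots\circ\Rightarrow_{\pi_k}$ (apply $\pi_1$ first), $\Rightarrow_\epsilon$ is the identity, $\Rightarrow_w^*$ its reflexive-transitive closure. The ARS is closed under substitutions if for all terms $s,t$, all $w\in\Pi^*$ and all substitutions $\theta$, $s\Rightarrow_w t$ implies $s\theta\Rightarrow_w t\theta$. Setting: $(T(\Sigma,X),\Rightarrow_\Pi)$ is closed under substitutions; $c_1$ is a term over $\Sigma\cup\{\square,\square'\}\cup X$ containing at least one occurrence of $\square$ and at least one of $\square'$, and $c_1[t,t']$ denotes $c_1$ with every $\square$ replaced by $t$ and every $\square'$ by $t'$; $c_2$ is a term over $\Sigma\cup\{\square\}\cup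 X$ with at least one $\square$, $c_2[t]$ replaces every $\square$ by $t$, $c_2^0=\square$, $c_2^{k+1}=c_2[c_2^k]$. There are $w_1,w_2\in\Pi^*$, variables $x\ne y$ not occurring in $c_1$, terms $s,t$ and $n_1,n_2,n_3,n_4\in\mathbb{N}$ with $u_1\Rightarrow_{w_1}v_1$ and $u_2\Rightarrow_{w_2}v_2$, where $u_1=c_1[x,c_2[y]]$, $v_1=c_1[c_2^{n_1}[x],y]$, $u_2=c_1[x,c_2^{n_2}[s]]$, $v_2=c_1[c_2^{n_3}[t],c_2^{n_4}[x]]$; moreover $c_2$ and $s$ contain no variables, $t\in\{x,s\}$, and $n_4\ge n_2$. For $m,n\in\mathbb{N}$, $c_1[m,n]$ denotes the term $c_1[c_2^m[s],c_2^n[s]]$. -}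

module Defs where

open import Data.Nat using (ℕ; zero; suc)
open import Data.Vec using (Vec; []; _∷_)
open import Data.Empty using (⊥)
open import Data.Unit using (⊤; tt)
open import Data.List using (List; []; _∷_)
open import Data.Product using (Σ; ∃; _×_; _,_)
open import Data.Sum using (_⊎_)
open import Relation.Nullary using (¬_)
open import Relation.Binary.PropositionalEquality using (_≡_)

record Signature : Set₁ where
  field
    Sym   : Set
    arity : Sym → ℕ
open Signature public

-- Terms over the signature S, the countably infinite variable set X = ℕ,
-- and extra fresh hole constants drawn from H.
-- T(Σ,X) is  Term S ⊥  (no hole constants).
data Term (S : Signature) (H : Set) : Set where
  var  : ℕ → Term S H
  hole : H → Term S H
  fun  : (f : Sym S) → Vec (Term S H) (arity S f) → Term S H

T : Signature → Set
T S = Term S ⊥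

data Hole2 : Set where
  □ □' : Hole2

mutual
  fill : ∀ {S H H'} → (H → Term S H') → Term S H → Term S H'
  fill σ (var x)    = var x
  fill σ (hole h)   = σ h
  fill σ (fun f ts) = fun f (fills σ ts)

  fills : ∀ {S H H' n} → (H → Term S H') → Vec (Term S H) n → Vec (Term S H') n
  fills σ []       = []
  fills σ (t ∷ ts) = fill σ t ∷ fills σ ts

mutual
  sub : ∀ {S H} → (ℕ → Term S H) → Term S H → Term S H
  sub θ (var x)    = θ x
  sub θ (hole h)   = hole h
  sub θ (fun f ts) = fun f (subs θ ts)

  subs : ∀ {S H n} → (ℕ → Term S H) → Vec (Term S H) n → Vec (Term S H) n
  subs θ []       = []
  subs θ (t ∷ ts) = sub θ t ∷ subs θ ts

mutual
  data HoleIn {S H} (h : H) : Term S H → Set where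
    here : HoleIn h (hole h)
    arg  : ∀ {f ts} → HoleInV h ts → HoleIn h (fun f ts)

  data HoleInV {S H} (h : H) : ∀ {n} → Vec (Term S H) n → Set where
    hd : ∀ {n t} {ts : Vec (Term S H) n} → HoleIn h t → HoleInV h (t ∷ ts)
    tl : ∀ {n t} {ts : Vec (Term S H) n} → HoleInV h ts → HoleInV h (t ∷ ts)

mutual
  data VarIn {S H} (x : ℕ) : Term S H → Set where
    here : VarIn x (var x)
    arg  : ∀ {f ts} → VarInV x ts → VarIn x (fun f ts)

  data VarInV {S H} (x : ℕ) : ∀ {n} → Vec (Term S H) n → Set where
    hd : ∀ {n t} {ts : Vec (Term S H) n} → VarIn x t → VarInV x (t ∷ ts)
    tl : ∀ {n t} {ts : Vec (Term S H) n} → VarInV x ts → VarInV x (t ∷ ts)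

Ground : ∀ {S H} → Term S H → Set
Ground t = ∀ x → ¬ VarIn x t

_[_,_]₂ : ∀ {S} → Term S Hole2 → T S → T S → T S
c [ t , t' ]₂ = fill (λ { □ → t ; □' → t' }) c

_[_]₁ : ∀ {S H} → Term S ⊤ → Term S H → Term S H
c [ t ]₁ = fill (λ _ → t) c

_^^_ : ∀ {S} → Term S ⊤ → ℕ → Term S ⊤
c ^^ zero  = hole tt
c ^^ suc k = c [ c ^^ k ]₁

-- ⇒_w for w = ⟨π₁,…,πₖ⟩ : apply π₁ first; ⇒_ε is the identity.
data Steps {S} {Π : Set} (R : Π → T S → T S → Set) : List Π → T S → T S → Set where
  done : ∀ {s} → Steps R [] s s
  step : ∀ {π w s u t} → R π s u → Steps R w u t → Steps R (π ∷ w) s t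

ClosedUnderSubst : ∀ {S} {Π : Set} → (Π → T S → T S → Set) → Set
ClosedUnderSubst {S} {Π} R =
  ∀ (w : List Π) (s t : T S) (θ : ℕ → T S) → Steps R w s t → Steps R w (sub θ s) (sub θ t)

-- Instantiating x ↦ c₂ᵐ[s], y ↦ c₂ⁿ[s] in the w₁-rule (closure under substitution; c₁, c₂ and s are
-- unaffected) gives c₁[m, n+1] ⇒_w₁ c₁[m+n₁, n]. Iterating n − n₂ times lowers the second index to
-- n₂, where instantiating x ↦ c₂ᵃ[s] in the w₂-rule gives c₁[a, n₂] ⇒_w₂ c₁[a', n₄ + a] with
-- a' = n₃ + a if t = x and a' = n₃ if t = s; and n₄ + a ≥ n₂.
module Submission where

open import Defs
open import Data.Nat using (ℕ; _≤_; suc; _+_; _*_; _∸_; _≟_)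
open import Data.Nat.Properties using (≤-trans; m≤m+n; +-assoc; +-comm; m∸n+n≡m)
open import Data.Unit using (⊤; tt)
open import Data.Empty using (⊥-elim)
open import Data.List using (List)
open import Data.Vec using (Vec; []; _∷_)
open import Data.Product using (Σ; ∃; _×_; _,_; proj₁; proj₂)
open import Data.Sum using (_⊎_; inj₁; inj₂)
open import Relation.Nullary using (¬_; yes; no)
open import Relation.Binary.PropositionalEquality
  using (_≡_; _≢_; refl; sym; trans; cong; cong₂; subst; subst₂; module ≡-Reasoning)
open import Relation.Binary.Construct.Closure.ReflexiveTransitive using (Star; ε; _◅_)

module _ {S : Signature} where

  mutual
    fill-cong : ∀ {H H'} {σ τ : H → Term S H'} → (∀ h → σ h ≡ τ h) →
                (c : Term S H) → fill σ c ≡ fill τ c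
    fill-cong e (var x)    = refl
    fill-cong e (hole h)   = e h
    fill-cong e (fun f ts) = cong (fun f) (fills-cong e ts)

    fills-cong : ∀ {H H' n} {σ τ : H → Term S H'} → (∀ h → σ h ≡ τ h) →
                 (ts : Vec (Term S H) n) → fills σ ts ≡ fills τ ts
    fills-cong e []       = refl
    fills-cong e (t ∷ ts) = cong₂ _∷_ (fill-cong e t) (fills-cong e ts)

  mutual
    fill-fill : ∀ {H H' H''} (σ : H → Term S H') (τ : H' → Term S H'') (c : Term S H) →
                fill τ (fill σ c) ≡ fill (λ h → fill τ (σ h)) c
    fill-fill σ τ (var x)    = refl
    fill-fill σ τ (hole h)   = refl
    fill-fill σ τ (fun f ts) = cong (fun f) (fills-fills σ τ ts)

    fills-fills : ∀ {H H' H'' n} (σ : H → Term S H') (τ : H' → Term S H'')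
                  (ts : Vec (Term S H) n) →
                  fills τ (fills σ ts) ≡ fills (λ h → fill τ (σ h)) ts
    fills-fills σ τ []       = refl
    fills-fills σ τ (t ∷ ts) = cong₂ _∷_ (fill-fill σ τ t) (fills-fills σ τ ts)

  mutual
    sub-fill : ∀ {H} (θ : ℕ → T S) (σ : H → T S) (c : Term S H) →
               (∀ z → VarIn z c → θ z ≡ var z) →
               sub θ (fill σ c) ≡ fill (λ h → sub θ (σ h)) c
    sub-fill θ σ (var x)    fixes = fixes x here
    sub-fill θ σ (hole h)   fixes = refl
    sub-fill θ σ (fun f ts) fixes = cong (fun f) (subs-fills θ σ ts (λ z z∈ → fixes z (arg z∈)))

    subs-fills : ∀ {H n} (θ : ℕ → T S) (σ : H → T S) (ts : Vec (Term S H) n) →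
                 (∀ z → VarInV z ts → θ z ≡ var z) →
                 subs θ (fills σ ts) ≡ fills (λ h → sub θ (σ h)) ts
    subs-fills θ σ []       fixes = refl
    subs-fills θ σ (t ∷ ts) fixes =
      cong₂ _∷_ (sub-fill θ σ t (λ z z∈ → fixes z (hd z∈)))
                (subs-fills θ σ ts (λ z z∈ → fixes z (tl z∈)))

  mutual
    sub-fixing : ∀ {H} (θ : ℕ → Term S H) (t : Term S H) →
                 (∀ z → VarIn z t → θ z ≡ var z) → sub θ t ≡ t
    sub-fixing θ (var x)    fixes = fixes x here
    sub-fixing θ (hole h)   fixes = refl
    sub-fixing θ (fun f ts) fixes = cong (fun f) (subs-fixing θ ts (λ z z∈ → fixes z (arg z∈)))

    subs-fixing : ∀ {H n} (θ : ℕ → Term S H) (ts : Vec (Term S H) n) →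
                  (∀ z → VarInV z ts → θ z ≡ var z) → subs θ ts ≡ ts
    subs-fixing θ []       fixes = refl
    subs-fixing θ (t ∷ ts) fixes =
      cong₂ _∷_ (sub-fixing θ t (λ z z∈ → fixes z (hd z∈)))
                (subs-fixing θ ts (λ z z∈ → fixes z (tl z∈)))

  sub-ground : ∀ {H} (θ : ℕ → Term S H) {t : Term S H} → Ground t → sub θ t ≡ t
  sub-ground θ {t} ground = sub-fixing θ t (λ z z∈ → ⊥-elim (ground z z∈))

  sub-[]₂ : (θ : ℕ → T S) (c : Term S Hole2) (A B : T S) →
            (∀ z → VarIn z c → θ z ≡ var z) →
            sub θ (c [ A , B ]₂) ≡ c [ sub θ A , sub θ B ]₂
  sub-[]₂ θ c A B fixes = trans (sub-fill θ _ c fixes) (fill-cong (λ { □ → refl ; □' → refl }) c)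

  sub-[]₁-ground : (θ : ℕ → T S) {c : Term S ⊤} → Ground c → (u : T S) →
                   sub θ (c [ u ]₁) ≡ c [ sub θ u ]₁
  sub-[]₁-ground θ {c} ground u = sub-fill θ _ c (λ z z∈ → ⊥-elim (ground z z∈))

  ^^-suc : (c : Term S ⊤) (k : ℕ) (u : T S) → (c ^^ suc k) [ u ]₁ ≡ c [ (c ^^ k) [ u ]₁ ]₁
  ^^-suc c k u = fill-fill _ _ c

  ^^-+ : (c : Term S ⊤) (a b : ℕ) (u : T S) →
         (c ^^ a) [ (c ^^ b) [ u ]₁ ]₁ ≡ (c ^^ (a + b)) [ u ]₁
  ^^-+ c 0       b u = refl
  ^^-+ c (suc a) b u = begin
    (c ^^ suc a) [ (c ^^ b) [ u ]₁ ]₁   ≡⟨ ^^-suc c a _ ⟩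
    c [ (c ^^ a) [ (c ^^ b) [ u ]₁ ]₁ ]₁ ≡⟨ cong (c [_]₁) (^^-+ c a b u) ⟩
    c [ (c ^^ (a + b)) [ u ]₁ ]₁         ≡⟨ sym (^^-suc c (a + b) u) ⟩
    (c ^^ suc (a + b)) [ u ]₁            ∎
    where open ≡-Reasoning

  sub-^^-ground : (θ : ℕ → T S) {c : Term S ⊤} → Ground c → (k : ℕ) (u : T S) →
                  sub θ ((c ^^ k) [ u ]₁) ≡ (c ^^ k) [ sub θ u ]₁
  sub-^^-ground θ         ground 0       u = refl
  sub-^^-ground θ {c} ground (suc k) u = begin
    sub θ ((c ^^ suc k) [ u ]₁)     ≡⟨ cong (sub θ) (^^-suc c k u) ⟩
    sub θ (c [ (c ^^ k) [ u ]₁ ]₁)  ≡⟨ sub-[]₁-ground θ ground _ ⟩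
    c [ sub θ ((c ^^ k) [ u ]₁) ]₁  ≡⟨ cong (c [_]₁) (sub-^^-ground θ ground k u) ⟩
    c [ (c ^^ k) [ sub θ u ]₁ ]₁    ≡⟨ sym (^^-suc c k _) ⟩
    (c ^^ suc k) [ sub θ u ]₁       ∎
    where open ≡-Reasoning

  bind₂ : ℕ → T S → ℕ → T S → ℕ → T S
  bind₂ x A y B z with z ≟ x | z ≟ y
  ... | yes _ | _     = A
  ... | no _  | yes _ = B
  ... | no _  | no _  = var z

  bind₂-x : ∀ x A y B → bind₂ x A y B x ≡ A
  bind₂-x x A y B with x ≟ x
  ... | yes _  = refl
  ... | no x≢x = ⊥-elim (x≢x refl)

  bind₂-y : ∀ {x y} A B → x ≢ y → bind₂ x A y B y ≡ B
  bind₂-y {x} {y} A B x≢y with y ≟ x | y ≟ y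
  ... | yes y≡x | _      = ⊥-elim (x≢y (sym y≡x))
  ... | no _    | yes _  = refl
  ... | no _    | no y≢y = ⊥-elim (y≢y refl)

  bind₂-fixes : ∀ {x y} A B (t : Term S Hole2) → ¬ VarIn x t → ¬ VarIn y t →
                ∀ z → VarIn z t → bind₂ x A y B z ≡ var z
  bind₂-fixes {x} {y} A B t x∉t y∉t z z∈t with z ≟ x | z ≟ y
  ... | yes refl | _        = ⊥-elim (x∉t z∈t)
  ... | no _     | yes refl = ⊥-elim (y∉t z∈t)
  ... | no _     | no _     = refl

module RecurrentPair
  {S : Signature} {Π : Set} {R : Π → T S → T S → Set} (closed : ClosedUnderSubst R)
  (c₁ : Term S Hole2) (c₂ : Term S ⊤) (c₂-ground : Ground c₂) (s : T S) (s-ground : Ground s)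
  {x y : ℕ} (x≢y : x ≢ y) (x∉c₁ : ¬ VarIn x c₁) (y∉c₁ : ¬ VarIn y c₁)
  where

  c₁⟨_,_⟩ : ℕ → ℕ → T S
  c₁⟨ m , n ⟩ = c₁ [ (c₂ ^^ m) [ s ]₁ , (c₂ ^^ n) [ s ]₁ ]₂

  at : ℕ → ℕ → ℕ → T S
  at m n = bind₂ x ((c₂ ^^ m) [ s ]₁) y ((c₂ ^^ n) [ s ]₁)

  instantiate : ∀ {w P Q P' Q'} m n → Steps R w (c₁ [ P , Q ]₂) (c₁ [ P' , Q' ]₂) →
                Steps R w (c₁ [ sub (at m n) P , sub (at m n) Q ]₂)
                          (c₁ [ sub (at m n) P' , sub (at m n) Q' ]₂)
  instantiate m n steps =
    subst₂ (Steps R _) (sub-[]₂ _ c₁ _ _ fixes) (sub-[]₂ _ c₁ _ _ fixes)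
           (closed _ _ _ (at m n) steps)
    where fixes = bind₂-fixes _ _ c₁ x∉c₁ y∉c₁

  at-^^-x : ∀ m n k → sub (at m n) ((c₂ ^^ k) [ var x ]₁) ≡ (c₂ ^^ (k + m)) [ s ]₁
  at-^^-x m n k = begin
    sub (at m n) ((c₂ ^^ k) [ var x ]₁) ≡⟨ sub-^^-ground (at m n) c₂-ground k (var x) ⟩
    (c₂ ^^ k) [ at m n x ]₁             ≡⟨ cong ((c₂ ^^ k) [_]₁) (bind₂-x x _ y _) ⟩
    (c₂ ^^ k) [ (c₂ ^^ m) [ s ]₁ ]₁     ≡⟨ ^^-+ c₂ k m s ⟩
    (c₂ ^^ (k + m)) [ s ]₁              ∎
    where open ≡-Reasoning

  at-^^-s : ∀ m n k → sub (at m n) ((c₂ ^^ k) [ s ]₁) ≡ (c₂ ^^ k) [ s ]₁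
  at-^^-s m n k =
    trans (sub-^^-ground (at m n) c₂-ground k s) (cong ((c₂ ^^ k) [_]₁) (sub-ground _ s-ground))

  at-c₂-y : ∀ m n → sub (at m n) (c₂ [ var y ]₁) ≡ (c₂ ^^ suc n) [ s ]₁
  at-c₂-y m n = begin
    sub (at m n) (c₂ [ var y ]₁) ≡⟨ sub-[]₁-ground (at m n) c₂-ground (var y) ⟩
    c₂ [ at m n y ]₁             ≡⟨ cong (c₂ [_]₁) (bind₂-y _ _ x≢y) ⟩
    c₂ [ (c₂ ^^ n) [ s ]₁ ]₁     ≡⟨ sym (^^-suc c₂ n s) ⟩
    (c₂ ^^ suc n) [ s ]₁         ∎
    where open ≡-Reasoning

  module _ {w₁ : List Π} (n₁ : ℕ)
    (rule₁ : Steps R w₁ (c₁ [ var x , c₂ [ var y ]₁ ]₂) (c₁ [ (c₂ ^^ n₁) [ var x ]₁ , var y ]₂))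
    where

    w₁-step : ∀ m n → Steps R w₁ c₁⟨ m , suc n ⟩ c₁⟨ n₁ + m , n ⟩
    w₁-step m n =
      subst₂ (Steps R w₁)
        (cong₂ (c₁ [_,_]₂) (bind₂-x x _ y _) (at-c₂-y m n))
        (cong₂ (c₁ [_,_]₂) (at-^^-x m n n₁) (bind₂-y _ _ x≢y))
        (instantiate m n rule₁)

    w₁-steps : ∀ k m n → Star (Steps R w₁) c₁⟨ m , k + n ⟩ c₁⟨ k * n₁ + m , n ⟩
    w₁-steps 0       m n = ε
    w₁-steps (suc k) m n =
      w₁-step m (k + n) ◅
        subst (λ a → Star (Steps R w₁) c₁⟨ n₁ + m , k + n ⟩ c₁⟨ a , n ⟩) reassoc
              (w₁-steps k (n₁ + m) n)
      where
      reassoc : k * n₁ + (n₁ + m) ≡ (n₁ + k * n₁) + m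
      reassoc = trans (sym (+-assoc (k * n₁) n₁ m)) (cong (_+ m) (+-comm (k * n₁) n₁))

  -- y does not occur in the w₂-rule, so its image under the instantiation is irrelevant.
  module _ {w₂ : List Π} {t : T S} (n₂ n₃ n₄ : ℕ)
    (rule₂ : Steps R w₂ (c₁ [ var x , (c₂ ^^ n₂) [ s ]₁ ]₂)
                        (c₁ [ (c₂ ^^ n₃) [ t ]₁ , (c₂ ^^ n₄) [ var x ]₁ ]₂))
    where

    w₂-instance : ∀ m m' → sub (at m 0) ((c₂ ^^ n₃) [ t ]₁) ≡ (c₂ ^^ m') [ s ]₁ →
                  Steps R w₂ c₁⟨ m , n₂ ⟩ c₁⟨ m' , n₄ + m ⟩
    w₂-instance m m' first =
      subst₂ (Steps R w₂)
        (cong₂ (c₁ [_,_]₂) (bind₂-x x _ y _) (at-^^-s m 0 n₂))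
        (cong₂ (c₁ [_,_]₂) first (at-^^-x m 0 n₄))
        (instantiate m 0 rule₂)

    w₂-step : t ≡ var x ⊎ t ≡ s → ∀ m → ∃ λ m' → Steps R w₂ c₁⟨ m , n₂ ⟩ c₁⟨ m' , n₄ + m ⟩
    w₂-step (inj₁ refl) m = n₃ + m , w₂-instance m (n₃ + m) (at-^^-x m 0 n₃)
    w₂-step (inj₂ refl) m = n₃     , w₂-instance m n₃ (at-^^-s m 0 n₃)

proposition1 : (S : Signature) (Π : Set) (R : Π → T S → T S → Set) →
    ClosedUnderSubst R →
    (c₁ : Term S Hole2) → HoleIn □ c₁ → HoleIn □' c₁ →
    (c₂ : Term S ⊤) → HoleIn tt c₂ →
    (w₁ w₂ : List Π) (x y : ℕ) → x ≢ y → ¬ VarIn x c₁ → ¬ VarIn y c₁ →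
    (s t : T S) (n₁ n₂ n₃ n₄ : ℕ) →
    Steps R w₁ (c₁ [ var x , c₂ [ var y ]₁ ]₂) (c₁ [ (c₂ ^^ n₁) [ var x ]₁ , var y ]₂) →
    Steps R w₂ (c₁ [ var x , (c₂ ^^ n₂) [ s ]₁ ]₂)
               (c₁ [ (c₂ ^^ n₃) [ t ]₁ , (c₂ ^^ n₄) [ var x ]₁ ]₂) →
    Ground c₂ → Ground s → (t ≡ var x ⊎ t ≡ s) → n₂ ≤ n₄ →
    (m n : ℕ) → n₂ ≤ n →
    Σ ℕ λ m' → Σ ℕ λ n' → n₂ ≤ n' ×
      Σ (T S) λ u →
        Star (Steps R w₁) (c₁ [ (c₂ ^^ m) [ s ]₁ , (c₂ ^^ n) [ s ]₁ ]₂) u ×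
        Steps R w₂ u (c₁ [ (c₂ ^^ m') [ s ]₁ , (c₂ ^^ n') [ s ]₁ ]₂)
proposition1 S Π R closed c₁ _ _ c₂ _ w₁ w₂ x y x≢y x∉c₁ y∉c₁ s t n₁ n₂ n₃ n₄
             rule₁ rule₂ c₂-ground s-ground t∈ n₂≤n₄ m n n₂≤n =
  m' , n₄ + a , ≤-trans n₂≤n₄ (m≤m+n n₄ a) , c₁⟨ a , n₂ ⟩ , descent , last
  where
  open RecurrentPair closed c₁ c₂ c₂-ground s s-ground x≢y x∉c₁ y∉c₁

  a : ℕ
  a = (n ∸ n₂) * n₁ + m

  descent : Star (Steps R w₁) c₁⟨ m , n ⟩ c₁⟨ a , n₂ ⟩
  descent = subst (λ j → Star (Steps R w₁) c₁⟨ m , j ⟩ c₁⟨ a , n₂ ⟩) (m∸n+n≡m n₂≤n)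
                  (w₁-steps n₁ rule₁ (n ∸ n₂) m n₂)

  m' : ℕ
  m' = proj₁ (w₂-step n₂ n₃ n₄ rule₂ t∈ a)

  last : Steps R w₂ c₁⟨ a , n₂ ⟩ c₁⟨ m' , n₄ + a ⟩
  last = proj₂ (w₂-step n₂ n₃ n₄ rule₂ t∈ a)
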